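{- Let $n\geqslant1$, let $v$ be an odd positive divisor of $n$, and $l=n/v$. Let $H\subseteq\{0,1,\dots,v-1\}\subseteq\mathbb{Z}_n$ with $0\in H$, and $X,Y\subseteq\mathbb{Z}_n$ satisfy: (i) $Y=H+v\mathbb{Z}_n$ and $X=Y\setminus v\mathbb{Z}_n$; (ii) $Y\uplus(-Y)=\mathbb{Z}_n\uplus v\mathbb{Z}_n$ as multisets. Then $Dih(n,X,Y)$ is a DSRG with parameters $\left(2n,\,n,\,\frac{n+l}{2},\,\frac{n-l}{2},\,\frac{n+l}{2}\right)$.
   Context: $D_n=\langle x,a\mid x^n=1,\ a^2=1,\ ax=x^{ -1}a\rangle$; $Dih(n,X,Y)$ is the Cayley digraph on $D_n$ with connection set $\{x^i:i\in X\}\cup\{x^ja:j\in Y\}$. A DSRG with parameters $(N,k,\mu,\lambda,t)$: adjacency matrix $A$ with $AJ=JA=kJ$ and $A^2=tI+\lambda A+\mu(J-I-A)$. $v\mathbb{Z}_n$ is the subgroup of multiples of $v$; $\uplus$ is multiset union. -}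

module Defs where

open import Data.Nat as ℕ using (ℕ; zero; suc; NonZero; _<?_)
open import Data.Nat.DivMod using (_mod_)
open import Data.Nat.Divisibility using (_∣_; _∣?_)
open import Data.Integer as ℤ using (ℤ; +_)
open import Data.Fin using (Fin; toℕ; _≟_)
open import Data.Fin.Subset using (Subset; _∈_)
open import Data.Fin.Subset.Properties using (_∈?_)
open import Data.Bool using (Bool; true; false; not; if_then_else_)
open import Data.Product using (_×_; _,_)
open import Relation.Nullary using (Dec; yes; no; does)
open import Relation.Nullary.Decidable using (⌊_⌋)
open import Relation.Binary.PropositionalEquality using (_≡_)

module _ (n : ℕ) .{{_ : NonZero n}} where

  addₙ : Fin n → Fin n → Fin n
  addₙ i j = (toℕ i ℕ.+ toℕ j) mod n

  negₙ : Fin n → Fin n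
  negₙ i = (n ℕ.∸ toℕ i) mod n

  subₙ : Fin n → Fin n → Fin n
  subₙ i j = addₙ i (negₙ j)

-- Dihedral group D_n = ⟨x, a | x^n = 1, a^2 = 1, a x = x⁻¹ a⟩.
-- The pair (i , false) stands for x^i, and (i , true) for x^i a.

Dih : ℕ → Set
Dih n = Fin n × Bool

module _ (n : ℕ) .{{_ : NonZero n}} where

  -- x^i a^b · x^j a^c = x^(i + (-1)^b j) a^(b+c)
  dmul : Dih n → Dih n → Dih n
  dmul (i , false) (j , c) = (addₙ n i j , c)
  dmul (i , true)  (j , c) = (subₙ n i j , not c)

  dinv : Dih n → Dih n
  dinv (i , false) = (negₙ n i , false)
  dinv (i , true)  = (i , true)

  inConn : Subset n → Subset n → Dih n → Bool
  inConn X Y (i , false) = does (i ∈? X)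
  inConn X Y (i , true)  = does (i ∈? Y)

  decode : Fin (2 ℕ.* n) → Dih n
  decode m = (toℕ m mod n , not ⌊ toℕ m <? n ⌋)

Mat : ℕ → Set
Mat N = Fin N → Fin N → ℤ

Σ : (N : ℕ) → (Fin N → ℤ) → ℤ
Σ zero    f = + 0
Σ (suc N) f = f Fin.zero ℤ.+ Σ N (λ i → f (Fin.suc i))

_·ᴹ_ : ∀ {N} → Mat N → Mat N → Mat N
_·ᴹ_ {N} A B i j = Σ N (λ w → A i w ℤ.* B w j)

Jᴹ : ∀ {N} → Mat N
Jᴹ i j = + 1

Iᴹ : ∀ {N} → Mat N
Iᴹ i j = if ⌊ i ≟ j ⌋ then + 1 else + 0

IsDSRG : (N k μ λ' t : ℕ) → Mat N → Set
IsDSRG N k μ λ' t A =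
    (∀ i j → (A ·ᴹ Jᴹ) i j ≡ + k ℤ.* Jᴹ i j)
  × (∀ i j → (Jᴹ ·ᴹ A) i j ≡ + k ℤ.* Jᴹ i j)
  × (∀ i j → (A ·ᴹ A) i j ≡
        + t ℤ.* Iᴹ i j ℤ.+ + λ' ℤ.* A i j
          ℤ.+ + μ ℤ.* (Jᴹ i j ℤ.- Iᴹ i j ℤ.- A i j))

DihAdj : (n : ℕ) .{{_ : NonZero n}} → Subset n → Subset n → Mat (2 ℕ.* n)
DihAdj n X Y p q =
  if inConn n X Y (dmul n (dinv n (decode n p)) (decode n q)) then + 1 else + 0

ind : ∀ {P : Set} → Dec P → ℕ
ind (yes _) = 1
ind (no _)  = 0

-- Write x, y and [v∣] for the indicators of X, Y and vℤₙ on ℤₙ. Condition (ii) says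
-- y(z) + y(−z) = 1 + [v∣](z); together with X = Y ∖ vℤₙ it gives x + [v∣] = y and
-- x(z) + y(−z) = 1, while (i) makes y invariant under translation by vℤₙ. Summing,
-- |Y| = |X| + l and 2|Y| = n + l, where l = n/v is the size of vℤₙ.
-- Adjacency g → h depends only on g⁻¹h, so (A²)(g, h) counts the factorisations
-- g⁻¹h = s t with s and t in the connection set. Splitting into rotations and
-- reflections and using the identities above, this count plus l·A(g, h) is |X| + l
-- for every pair, which is the DSRG equation for μ = |X| + l and λ = |X|; the row
-- and column sums are |X| + |Y| = n.

module Submission where

open import Defs
open import Data.Nat using (ℕ; NonZero; _<_; _+_; _*_; _∸_; _/_; _%_)
open import Data.Nat.DivMod using (_mod_)
open import Data.Nat.Divisibility using (_∣_; _∣?_)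
open import Data.Fin using (Fin; toℕ)
open import Data.Fin.Subset using (Subset; _∈_)
open import Data.Fin.Subset.Properties using (_∈?_)
open import Data.Product using (_×_; ∃; ∃-syntax)
open import Function.Bundles using (_⇔_)
open import Relation.Nullary using (¬_)
open import Relation.Binary.PropositionalEquality using (_≡_)

open import Algebra.Bundles using (AbelianGroup; Group)
open import Algebra.Structures using (IsAbelianGroup; IsGroup)
import Algebra.Properties.AbelianGroup as AbelianGroupProperties
import Algebra.Properties.Group as GroupProperties
open import Data.Bool using (true; false; not; if_then_else_)
open import Data.Bool.Properties using (not-involutive)
open import Data.Fin using (_↑ˡ_; _↑ʳ_) renaming (zero to fzero; suc to fsuc)
open import Data.Fin.Permutation using (permutation)
open import Data.Fin.Properties using (toℕ-injective; toℕ-fromℕ<; toℕ<n; toℕ-↑ˡ; toℕ-↑ʳ)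
open import Data.Integer as ℤ using (ℤ; +_)
import Data.Integer.Properties as ℤ
import Data.Integer.Tactic.RingSolver as ℤ
open import Data.Nat as ℕ using (zero; suc; s≤s; _<?_)
open import Data.Nat.DivMod
open import Data.Nat.Divisibility
  using (divides; _∣0; ∣-refl; >⇒∤; ∣m+n∣m⇒∣n; ∣m∣n⇒∣m+n; %-presˡ-∣)
open import Data.Nat.Properties as ℕ using (+-*-semiring)
open import Data.Nat.Tactic.RingSolver using (solve-∀)
open import Algebra.Properties.CommutativeSemigroup ℕ.+-commutativeSemigroup using (xy∙z≈xz∙y)
open import Data.Product using (_,_; proj₁; proj₂)
open import Function using (_∘_)
open import Function.Bundles using (Equivalence)
open import Level using (0ℓ)
open import Relation.Nullary using (Dec; yes; no; does; _because_; contradiction)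
open import Relation.Nullary.Decidable using (dec-true; dec-false; isYes)
open import Relation.Binary.PropositionalEquality
  using (refl; sym; trans; cong; cong₂; subst; isEquivalence; module ≡-Reasoning)
open import Algebra.Properties.Semiring.Sum +-*-semiring
  using (sum; sum-syntax; sum-cong-≗; ∑-distrib-+; *-distribʳ-sum; sum-permute)
open ≡-Reasoning

isYes≡does : ∀ {P : Set} (P? : Dec P) → isYes P? ≡ does P?
isYes≡does (true  because _) = refl
isYes≡does (false because _) = refl

ind-yes : ∀ {P : Set} (P? : Dec P) → P → ind P? ≡ 1
ind-yes (yes _) _ = refl
ind-yes (no ¬p) p = contradiction p ¬p

ind-no : ∀ {P : Set} (P? : Dec P) → ¬ P → ind P? ≡ 0
ind-no (yes p) ¬p = contradiction p ¬p
ind-no (no _)  _  = refl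

ind-cong : ∀ {P Q : Set} (P? : Dec P) (Q? : Dec Q) → (P → Q) → (Q → P) → ind P? ≡ ind Q?
ind-cong P? (yes q) _   Q→P = ind-yes P? (Q→P q)
ind-cong P? (no ¬q) P→Q _   = ind-no P? (¬q ∘ P→Q)

ind+ind≡2⇒P : ∀ {P Q : Set} (P? : Dec P) (Q? : Dec Q) → ind P? + ind Q? ≡ 2 → P
ind+ind≡2⇒P (yes p) _       _  = p
ind+ind≡2⇒P (no _)  (yes _) ()
ind+ind≡2⇒P (no _)  (no _)  ()

ind*-cong : ∀ {P : Set} (P? : Dec P) {a b : ℕ} → (P → a ≡ b) → ind P? * a ≡ ind P? * b
ind*-cong (yes p) a≡b = cong (_+ 0) (a≡b p)
ind*-cong (no _)  _   = refl

if-does : ∀ {P : Set} (P? : Dec P) → (if does P? then + 1 else + 0) ≡ + ind P?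
if-does (yes _) = refl
if-does (no _)  = refl

∑-reindex : ∀ {N} (σ τ : Fin N → Fin N) → (∀ i → σ (τ i) ≡ i) → (∀ i → τ (σ i) ≡ i) →
            (f : Fin N → ℕ) → ∑[ i < N ] f (σ i) ≡ ∑[ i < N ] f i
∑-reindex σ τ στ τσ f = sym (sum-permute f (permutation σ τ στ τσ))

∑-↑ : ∀ a b (f : Fin (a + b) → ℕ) →
      ∑[ i < a + b ] f i ≡ ∑[ i < a ] f (i ↑ˡ b) + ∑[ j < b ] f (a ↑ʳ j)
∑-↑ zero    b f = refl
∑-↑ (suc a) b f = trans (cong (_+_ (f fzero)) (∑-↑ a b (λ i → f (fsuc i))))
                        (sym (ℕ.+-assoc (f fzero) _ _))

∑-const : ∀ N c → ∑[ i < N ] c ≡ N * c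
∑-const zero    c = refl
∑-const (suc N) c = cong (_+_ c) (∑-const N c)

Σ-cong : ∀ {N} {f g : Fin N → ℤ} → (∀ i → f i ≡ g i) → Σ N f ≡ Σ N g
Σ-cong {zero}  f≗g = refl
Σ-cong {suc N} f≗g = cong₂ ℤ._+_ (f≗g fzero) (Σ-cong (λ i → f≗g (fsuc i)))

Σ-pos : ∀ N (f : Fin N → ℕ) → Σ N (λ i → + f i) ≡ + ∑[ i < N ] f i
Σ-pos zero    f = refl
Σ-pos (suc N) f = trans (cong (ℤ._+_ (+ f fzero)) (Σ-pos N (λ i → f (fsuc i))))
                        (sym (ℤ.pos-+ (f fzero) _))

∑-multiples : ∀ v q .{{_ : NonZero v}} → ∑[ k < q * v ] ind (v ∣? toℕ k) ≡ q
∑-multiples v zero    = refl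
∑-multiples v (suc q) = begin
  ∑[ k < v + q * v ] ind (v ∣? toℕ k)
    ≡⟨ ∑-↑ v (q * v) (λ k → ind (v ∣? toℕ k)) ⟩
  ∑[ i < v ] ind (v ∣? toℕ (i ↑ˡ q * v)) + ∑[ k < q * v ] ind (v ∣? toℕ (v ↑ʳ k))
    ≡⟨ cong₂ _+_ (one-below v) (sum-cong-≗ shift) ⟩
  1 + ∑[ k < q * v ] ind (v ∣? toℕ k)
    ≡⟨ cong suc (∑-multiples v q) ⟩
  1 + q ∎
  where
  one-below : ∀ w .{{_ : NonZero w}} → ∑[ i < w ] ind (w ∣? toℕ (i ↑ˡ q * v)) ≡ 1
  one-below (suc w) = cong₂ _+_ (ind-yes (suc w ∣? 0) (suc w ∣0)) (begin
    ∑[ i < w ] ind (suc w ∣? suc (toℕ (i ↑ˡ q * v)))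
      ≡⟨ sum-cong-≗ (λ i → ind-no (suc w ∣? _) (>⇒∤ (s≤s (subst (_< w) (sym (toℕ-↑ˡ i (q * v))) (toℕ<n i))))) ⟩
    ∑[ i < w ] 0 ≡⟨ ∑-const w 0 ⟩
    w * 0        ≡⟨ ℕ.*-zeroʳ w ⟩
    0            ∎)
  shift : ∀ (k : Fin (q * v)) → ind (v ∣? toℕ (v ↑ʳ k)) ≡ ind (v ∣? toℕ k)
  shift k = ind-cong (v ∣? _) (v ∣? _)
    (λ v∣v+k → ∣m+n∣m⇒∣n (subst (v ∣_) (toℕ-↑ʳ v k) v∣v+k) ∣-refl)
    (λ v∣k → subst (v ∣_) (sym (toℕ-↑ʳ v k)) (∣m∣n⇒∣m+n ∣-refl v∣k))

[n+l]/2≡a+l : ∀ {n} a l → n ≡ a + a + l → (n + l) / 2 ≡ a + l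
[n+l]/2≡a+l a l refl = trans (cong (_/ 2) (a+a+l+l≡[a+l]*2 a l)) (m*n/n≡m (a + l) 2)
  where
  a+a+l+l≡[a+l]*2 : ∀ a l → a + a + l + l ≡ (a + l) * 2
  a+a+l+l≡[a+l]*2 = solve-∀

[n∸l]/2≡a : ∀ {n} a l → n ≡ a + a + l → (n ∸ l) / 2 ≡ a
[n∸l]/2≡a a l refl = trans (cong (_/ 2) (trans (ℕ.m+n∸n≡m (a + a) l) (a+a≡a*2 a))) (m*n/n≡m a 2)
  where
  a+a≡a*2 : ∀ a → a + a ≡ a * 2
  a+a≡a*2 = solve-∀

-- With μ = λ′ + l the right-hand side is μ − l·a, so the DSRG equation reduces to A² + l·A = μ J.
dsrg-entry : ∀ {μ λ′ l a N : ℕ} (I : ℤ) → μ ≡ λ′ + l → N + l * a ≡ μ →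
             + N ≡ + μ ℤ.* I ℤ.+ + λ′ ℤ.* + a ℤ.+ + μ ℤ.* (+ 1 ℤ.- I ℤ.- + a)
dsrg-entry {λ′ = λ′} {l} {a} {N} I refl N+la≡μ = begin
  + N                                      ≡⟨ x≡[x+y]-y (+ N) (+ l ℤ.* + a) ⟩
  (+ N ℤ.+ + l ℤ.* + a) ℤ.- + l ℤ.* + a    ≡⟨ cong (ℤ._- + l ℤ.* + a) N+la≡λ′+l ⟩
  (+ λ′ ℤ.+ + l) ℤ.- + l ℤ.* + a           ≡⟨ entry (+ λ′) (+ l) (+ a) I ⟩
  (+ λ′ ℤ.+ + l) ℤ.* I ℤ.+ + λ′ ℤ.* + a ℤ.+ (+ λ′ ℤ.+ + l) ℤ.* (+ 1 ℤ.- I ℤ.- + a)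
    ≡⟨ cong (λ μ → μ ℤ.* I ℤ.+ + λ′ ℤ.* + a ℤ.+ μ ℤ.* (+ 1 ℤ.- I ℤ.- + a)) (ℤ.pos-+ λ′ l) ⟨
  + (λ′ + l) ℤ.* I ℤ.+ + λ′ ℤ.* + a ℤ.+ + (λ′ + l) ℤ.* (+ 1 ℤ.- I ℤ.- + a) ∎
  where
  N+la≡λ′+l : + N ℤ.+ + l ℤ.* + a ≡ + λ′ ℤ.+ + l
  N+la≡λ′+l = begin
    + N ℤ.+ + l ℤ.* + a  ≡⟨ cong (ℤ._+_ (+ N)) (ℤ.pos-* l a) ⟨
    + N ℤ.+ + (l * a)    ≡⟨ ℤ.pos-+ N (l * a) ⟨
    + (N + l * a)        ≡⟨ cong +_ N+la≡μ ⟩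
    + (λ′ + l)           ≡⟨ ℤ.pos-+ λ′ l ⟩
    + λ′ ℤ.+ + l         ∎
  x≡[x+y]-y : ∀ x y → x ≡ (x ℤ.+ y) ℤ.- y
  x≡[x+y]-y = ℤ.solve-∀
  entry : ∀ Λ L A I → (Λ ℤ.+ L) ℤ.- L ℤ.* A ≡ (Λ ℤ.+ L) ℤ.* I ℤ.+ Λ ℤ.* A ℤ.+ (Λ ℤ.+ L) ℤ.* (+ 1 ℤ.- I ℤ.- A)
  entry = ℤ.solve-∀

module ℤₙ (n : ℕ) .{{_ : NonZero n}} where

  infixl 6 _+ₙ_
  infix 8 -ₙ_

  _+ₙ_ : Fin n → Fin n → Fin n
  _+ₙ_ = addₙ n

  -ₙ_ : Fin n → Fin n
  -ₙ_ = negₙ n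

  0ₙ : Fin n
  0ₙ = 0 mod n

  toℕ-mod : ∀ m → toℕ (m mod n) ≡ m % n
  toℕ-mod m = toℕ-fromℕ< (m%n<n m n)

  mod-cong : ∀ {a b} → a % n ≡ b % n → a mod n ≡ b mod n
  mod-cong {a} {b} e = toℕ-injective (begin
    toℕ (a mod n) ≡⟨ toℕ-mod a ⟩
    a % n         ≡⟨ e ⟩
    b % n         ≡⟨ toℕ-mod b ⟨
    toℕ (b mod n) ∎)

  [a%n+b]%n≡[a+b]%n : ∀ a b → (a % n + b) % n ≡ (a + b) % n
  [a%n+b]%n≡[a+b]%n a b = begin
    (a % n + b) % n         ≡⟨ %-distribˡ-+ (a % n) b n ⟩
    (a % n % n + b % n) % n ≡⟨ cong (λ z → (z + b % n) % n) (m%n%n≡m%n a n) ⟩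
    (a % n + b % n) % n     ≡⟨ %-distribˡ-+ a b n ⟨
    (a + b) % n             ∎

  [a+b%n]%n≡[a+b]%n : ∀ a b → (a + b % n) % n ≡ (a + b) % n
  [a+b%n]%n≡[a+b]%n a b = begin
    (a + b % n) % n ≡⟨ cong (_% n) (ℕ.+-comm a (b % n)) ⟩
    (b % n + a) % n ≡⟨ [a%n+b]%n≡[a+b]%n b a ⟩
    (b + a) % n     ≡⟨ cong (_% n) (ℕ.+-comm b a) ⟩
    (a + b) % n     ∎

  toℕ-mod-toℕ : ∀ (k : Fin n) → toℕ k mod n ≡ k
  toℕ-mod-toℕ k = toℕ-injective (trans (toℕ-mod (toℕ k)) (m<n⇒m%n≡m (toℕ<n k)))

  toℕ-0ₙ : toℕ 0ₙ ≡ 0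
  toℕ-0ₙ = trans (toℕ-mod 0) (m<n⇒m%n≡m (ℕ.>-nonZero⁻¹ n))

  +ₙ-assoc : ∀ a b c → (a +ₙ b) +ₙ c ≡ a +ₙ (b +ₙ c)
  +ₙ-assoc a b c = mod-cong (begin
    (toℕ ((toℕ a + toℕ b) mod n) + toℕ c) % n ≡⟨ cong (λ z → (z + toℕ c) % n) (toℕ-mod _) ⟩
    ((toℕ a + toℕ b) % n + toℕ c) % n         ≡⟨ [a%n+b]%n≡[a+b]%n _ _ ⟩
    (toℕ a + toℕ b + toℕ c) % n               ≡⟨ cong (_% n) (ℕ.+-assoc (toℕ a) _ _) ⟩
    (toℕ a + (toℕ b + toℕ c)) % n             ≡⟨ [a+b%n]%n≡[a+b]%n _ _ ⟨
    (toℕ a + (toℕ b + toℕ c) % n) % n         ≡⟨ cong (λ z → (toℕ a + z) % n) (toℕ-mod _) ⟨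
    (toℕ a + toℕ ((toℕ b + toℕ c) mod n)) % n ∎)

  +ₙ-comm : ∀ a b → a +ₙ b ≡ b +ₙ a
  +ₙ-comm a b = cong (_mod n) (ℕ.+-comm (toℕ a) (toℕ b))

  +ₙ-identityˡ : ∀ a → 0ₙ +ₙ a ≡ a
  +ₙ-identityˡ a = toℕ-injective (begin
    toℕ ((toℕ 0ₙ + toℕ a) mod n) ≡⟨ toℕ-mod _ ⟩
    (toℕ 0ₙ + toℕ a) % n         ≡⟨ cong (λ z → (z + toℕ a) % n) toℕ-0ₙ ⟩
    toℕ a % n                    ≡⟨ m<n⇒m%n≡m (toℕ<n a) ⟩
    toℕ a                        ∎)

  +ₙ-identityʳ : ∀ a → a +ₙ 0ₙ ≡ a
  +ₙ-identityʳ a = trans (+ₙ-comm a 0ₙ) (+ₙ-identityˡ a)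

  +ₙ-inverseʳ : ∀ a → a +ₙ -ₙ a ≡ 0ₙ
  +ₙ-inverseʳ a = mod-cong (begin
    (toℕ a + toℕ ((n ∸ toℕ a) mod n)) % n ≡⟨ cong (λ z → (toℕ a + z) % n) (toℕ-mod _) ⟩
    (toℕ a + (n ∸ toℕ a) % n) % n         ≡⟨ [a+b%n]%n≡[a+b]%n _ _ ⟩
    (toℕ a + (n ∸ toℕ a)) % n             ≡⟨ cong (_% n) (ℕ.m+[n∸m]≡n (ℕ.<⇒≤ (toℕ<n a))) ⟩
    n % n                                 ≡⟨ n%n≡0 n ⟩
    0                                     ≡⟨ m<n⇒m%n≡m (ℕ.>-nonZero⁻¹ n) ⟨
    0 % n                                 ∎)

  +ₙ-inverseˡ : ∀ a → -ₙ a +ₙ a ≡ 0ₙ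
  +ₙ-inverseˡ a = trans (+ₙ-comm (-ₙ a) a) (+ₙ-inverseʳ a)

  +ₙ-isAbelianGroup : IsAbelianGroup _≡_ _+ₙ_ 0ₙ -ₙ_
  +ₙ-isAbelianGroup = record
    { isGroup = record
      { isMonoid = record
        { isSemigroup = record
          { isMagma = record { isEquivalence = isEquivalence ; ∙-cong = cong₂ _+ₙ_ }
          ; assoc = +ₙ-assoc
          }
        ; identity = +ₙ-identityˡ , +ₙ-identityʳ
        }
      ; inverse = +ₙ-inverseˡ , +ₙ-inverseʳ
      ; ⁻¹-cong = cong -ₙ_
      }
    ; comm = +ₙ-comm
    }

  +ₙ-abelianGroup : AbelianGroup 0ℓ 0ℓ
  +ₙ-abelianGroup = record { isAbelianGroup = +ₙ-isAbelianGroup }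

  open AbelianGroup +ₙ-abelianGroup public using (_-_)
  open GroupProperties (AbelianGroup.group +ₙ-abelianGroup) using (\\-leftDividesˡ; \\-leftDividesʳ)
  open GroupProperties (AbelianGroup.group +ₙ-abelianGroup) public
    using () renaming (⁻¹-involutive to -ₙ-involutive; ε⁻¹≈ε to -ₙ0ₙ≡0ₙ)
  open AbelianGroupProperties +ₙ-abelianGroup using (⁻¹-∙-comm)

  -ₙ-distrib-+ₙ : ∀ a b → -ₙ (a +ₙ b) ≡ -ₙ a +ₙ -ₙ b
  -ₙ-distrib-+ₙ a b = sym (⁻¹-∙-comm a b)

  -ₙa+ₙ[a+ₙb]≡b : ∀ a b → -ₙ a +ₙ (a +ₙ b) ≡ b
  -ₙa+ₙ[a+ₙb]≡b = \\-leftDividesʳ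

  -ₙ[a-b]≡-ₙa+ₙb : ∀ a b → -ₙ (a - b) ≡ -ₙ a +ₙ b
  -ₙ[a-b]≡-ₙa+ₙb a b = trans (-ₙ-distrib-+ₙ a (-ₙ b)) (cong (-ₙ a +ₙ_) (-ₙ-involutive b))

  -ₙ[-ₙa+ₙb]≡a-b : ∀ a b → -ₙ (-ₙ a +ₙ b) ≡ a - b
  -ₙ[-ₙa+ₙb]≡a-b a b = trans (-ₙ-distrib-+ₙ (-ₙ a) b) (cong (_+ₙ -ₙ b) (-ₙ-involutive a))

  ∑-+ₙˡ : ∀ a (f : Fin n → ℕ) → ∑[ u < n ] f (a +ₙ u) ≡ ∑[ u < n ] f u
  ∑-+ₙˡ a = ∑-reindex (a +ₙ_) (-ₙ a +ₙ_) (\\-leftDividesˡ a) (\\-leftDividesʳ a)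

  ∑--ₙ : ∀ (f : Fin n → ℕ) → ∑[ u < n ] f (-ₙ u) ≡ ∑[ u < n ] f u
  ∑--ₙ = ∑-reindex -ₙ_ -ₙ_ -ₙ-involutive -ₙ-involutive

  ∑-reflect : ∀ a (f : Fin n → ℕ) → ∑[ u < n ] f (a - u) ≡ ∑[ u < n ] f u
  ∑-reflect a f = trans (∑--ₙ (λ w → f (a +ₙ w))) (∑-+ₙˡ a f)

module Dihedral (n : ℕ) .{{_ : NonZero n}} where

  open ℤₙ n

  ε : Dih n
  ε = 0ₙ , false

  dmul-assoc : ∀ g h k → dmul n (dmul n g h) k ≡ dmul n g (dmul n h k)
  dmul-assoc (i , false) (j , false) (k , c) = cong (_, c) (+ₙ-assoc i j k)
  dmul-assoc (i , false) (j , true)  (k , c) = cong (_, not c) (+ₙ-assoc i j (-ₙ k))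
  dmul-assoc (i , true)  (j , false) (k , c) = cong (_, not c) (begin
    i - j - k         ≡⟨ +ₙ-assoc i (-ₙ j) (-ₙ k) ⟩
    i +ₙ (-ₙ j - k)   ≡⟨ cong (i +ₙ_) (sym (-ₙ-distrib-+ₙ j k)) ⟩
    i - (j +ₙ k)      ∎)
  dmul-assoc (i , true)  (j , true)  (k , c) = cong₂ _,_ (begin
    i - j +ₙ k            ≡⟨ +ₙ-assoc i (-ₙ j) k ⟩
    i +ₙ (-ₙ j +ₙ k)      ≡⟨ cong (λ z → i +ₙ (-ₙ j +ₙ z)) (-ₙ-involutive k) ⟨
    i +ₙ (-ₙ j - -ₙ k)    ≡⟨ cong (i +ₙ_) (sym (-ₙ-distrib-+ₙ j (-ₙ k))) ⟩
    i - (j - k)           ∎) (sym (not-involutive c))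

  dmul-identityˡ : ∀ g → dmul n ε g ≡ g
  dmul-identityˡ (j , c) = cong (_, c) (+ₙ-identityˡ j)

  dmul-identityʳ : ∀ g → dmul n g ε ≡ g
  dmul-identityʳ (i , false) = cong (_, false) (+ₙ-identityʳ i)
  dmul-identityʳ (i , true)  = cong (_, true) (trans (cong (i +ₙ_) -ₙ0ₙ≡0ₙ) (+ₙ-identityʳ i))

  dmul-inverseˡ : ∀ g → dmul n (dinv n g) g ≡ ε
  dmul-inverseˡ (i , false) = cong (_, false) (+ₙ-inverseˡ i)
  dmul-inverseˡ (i , true)  = cong (_, false) (+ₙ-inverseʳ i)

  dmul-inverseʳ : ∀ g → dmul n g (dinv n g) ≡ ε
  dmul-inverseʳ (i , false) = cong (_, false) (+ₙ-inverseʳ i)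
  dmul-inverseʳ (i , true)  = cong (_, false) (+ₙ-inverseʳ i)

  dmul-isGroup : IsGroup _≡_ (dmul n) ε (dinv n)
  dmul-isGroup = record
    { isMonoid = record
      { isSemigroup = record
        { isMagma = record { isEquivalence = isEquivalence ; ∙-cong = cong₂ (dmul n) }
        ; assoc = dmul-assoc
        }
      ; identity = dmul-identityˡ , dmul-identityʳ
      }
    ; inverse = dmul-inverseˡ , dmul-inverseʳ
    ; ⁻¹-cong = cong (dinv n)
    }

  Dₙ : Group 0ℓ 0ℓ
  Dₙ = record { isGroup = dmul-isGroup }

  open Group Dₙ public using (_\\_)
  open GroupProperties Dₙ using (\\-leftDividesʳ; ⁻¹-anti-homo-∙; ⁻¹-anti-homo-\\)

  ∑ᴰ : (Dih n → ℕ) → ℕ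
  ∑ᴰ F = ∑[ k < n ] F (k , false) + ∑[ k < n ] F (k , true)

  ∑ᴰ-cong : ∀ {F G : Dih n → ℕ} → (∀ d → F d ≡ G d) → ∑ᴰ F ≡ ∑ᴰ G
  ∑ᴰ-cong F≗G = cong₂ _+_ (sum-cong-≗ (λ k → F≗G (k , false))) (sum-cong-≗ (λ k → F≗G (k , true)))

  ∑ᴰ-translate : ∀ g F → ∑ᴰ (λ d → F (dmul n g d)) ≡ ∑ᴰ F
  ∑ᴰ-translate (i , false) F =
    cong₂ _+_ (∑-+ₙˡ i (λ u → F (u , false))) (∑-+ₙˡ i (λ u → F (u , true)))
  ∑ᴰ-translate (i , true)  F =
    trans (cong₂ _+_ (∑-reflect i (λ u → F (u , true))) (∑-reflect i (λ u → F (u , false))))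
          (ℕ.+-comm (∑[ u < n ] F (u , true)) _)

  ∑ᴰ-invert : ∀ F → ∑ᴰ (λ d → F (dinv n d)) ≡ ∑ᴰ F
  ∑ᴰ-invert F = cong (_+ ∑[ k < n ] F (k , true)) (∑--ₙ (λ u → F (u , false)))

  ∑ᴰ-\\ˡ : ∀ g F → ∑ᴰ (λ d → F (g \\ d)) ≡ ∑ᴰ F
  ∑ᴰ-\\ˡ g F = begin
    ∑ᴰ (λ d → F (g \\ d))            ≡⟨ ∑ᴰ-translate g (λ d → F (g \\ d)) ⟨
    ∑ᴰ (λ d → F (g \\ dmul n g d))   ≡⟨ ∑ᴰ-cong (λ d → cong F (\\-leftDividesʳ g d)) ⟩
    ∑ᴰ F                             ∎

  ∑ᴰ-\\ʳ : ∀ h F → ∑ᴰ (λ d → F (d \\ h)) ≡ ∑ᴰ F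
  ∑ᴰ-\\ʳ h F = begin
    ∑ᴰ (λ d → F (d \\ h))            ≡⟨ ∑ᴰ-translate h (λ d → F (d \\ h)) ⟨
    ∑ᴰ (λ d → F (dmul n h d \\ h))   ≡⟨ ∑ᴰ-cong (λ d → cong F (begin
        dmul n h d \\ h                  ≡⟨ ⁻¹-anti-homo-\\ h (dmul n h d) ⟨
        dinv n (h \\ dmul n h d)         ≡⟨ cong (dinv n) (\\-leftDividesʳ h d) ⟩
        dinv n d                         ∎)) ⟩
    ∑ᴰ (λ d → F (dinv n d))          ≡⟨ ∑ᴰ-invert F ⟩
    ∑ᴰ F                             ∎

  ∑ᴰ-walks : ∀ g h (F G : Dih n → ℕ) →
             ∑ᴰ (λ d → F (g \\ d) * G (d \\ h)) ≡ ∑ᴰ (λ d → F d * G (d \\ (g \\ h)))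
  ∑ᴰ-walks g h F G = begin
    ∑ᴰ (λ d → F (g \\ d) * G (d \\ h))                          ≡⟨ ∑ᴰ-translate g (λ d → F (g \\ d) * G (d \\ h)) ⟨
    ∑ᴰ (λ d → F (g \\ dmul n g d) * G (dmul n g d \\ h))        ≡⟨ ∑ᴰ-cong (λ d →
        cong₂ (λ a b → F a * G b) (\\-leftDividesʳ g d) (\\-assoc g d)) ⟩
    ∑ᴰ (λ d → F d * G (d \\ (g \\ h)))                          ∎
    where
    \\-assoc : ∀ g d → dmul n g d \\ h ≡ d \\ (g \\ h)
    \\-assoc g d = trans (cong (λ z → dmul n z h) (⁻¹-anti-homo-∙ g d)) (dmul-assoc (dinv n d) (dinv n g) h)

  decode-↑ˡ : ∀ k → decode n (k ↑ˡ (n + 0)) ≡ (k , false)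
  decode-↑ˡ k = cong₂ _,_
    (trans (cong (_mod n) (toℕ-↑ˡ k (n + 0))) (toℕ-mod-toℕ k))
    (cong not (trans (isYes≡does (toℕ (k ↑ˡ (n + 0)) <? n))
                     (dec-true (toℕ (k ↑ˡ (n + 0)) <? n) (subst (_< n) (sym (toℕ-↑ˡ k (n + 0))) (toℕ<n k)))))

  decode-↑ʳ : ∀ k → decode n (n ↑ʳ (k ↑ˡ 0)) ≡ (k , true)
  decode-↑ʳ k = cong₂ _,_
    (trans (mod-cong (trans (cong (_% n) toℕ-p) (%-remove-+ˡ (toℕ k) ∣-refl))) (toℕ-mod-toℕ k))
    (cong not (trans (isYes≡does (toℕ (n ↑ʳ (k ↑ˡ 0)) <? n))
                     (dec-false (toℕ (n ↑ʳ (k ↑ˡ 0)) <? n) (λ p<n → ℕ.m+n≮m n (toℕ k) (subst (_< n) toℕ-p p<n)))))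
    where
    toℕ-p : toℕ (n ↑ʳ (k ↑ˡ 0)) ≡ n + toℕ k
    toℕ-p = trans (toℕ-↑ʳ n (k ↑ˡ 0)) (cong (_+_ n) (toℕ-↑ˡ k 0))

  -- 2 * n unfolds to n + (n + 0): decode lists the rotations first, then the reflections.
  Σ-decode : ∀ F → Σ (2 * n) (λ p → + F (decode n p)) ≡ + ∑ᴰ F
  Σ-decode F = trans (Σ-pos (2 * n) (λ p → F (decode n p))) (cong +_ (begin
    ∑[ p < n + (n + 0) ] F (decode n p)
      ≡⟨ ∑-↑ n (n + 0) (λ p → F (decode n p)) ⟩
    ∑[ k < n ] F (decode n (k ↑ˡ (n + 0))) + ∑[ j < n + 0 ] F (decode n (n ↑ʳ j))
      ≡⟨ cong (_+_ (∑[ k < n ] F (decode n (k ↑ˡ (n + 0)))))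
              (trans (∑-↑ n 0 (λ j → F (decode n (n ↑ʳ j)))) (ℕ.+-identityʳ _)) ⟩
    ∑[ k < n ] F (decode n (k ↑ˡ (n + 0))) + ∑[ k < n ] F (decode n (n ↑ʳ (k ↑ˡ 0)))
      ≡⟨ cong₂ _+_ (sum-cong-≗ (cong F ∘ decode-↑ˡ)) (sum-cong-≗ (cong F ∘ decode-↑ʳ)) ⟩
    ∑ᴰ F ∎))

  module CayleyMatrix (F : Dih n → ℕ) (M : Mat (2 * n))
                      (M-entry : ∀ p q → M p q ≡ + F (decode n p \\ decode n q)) where

    M·J≡∑ : ∀ p q → (M ·ᴹ Jᴹ) p q ≡ + ∑ᴰ F
    M·J≡∑ p q = begin
      Σ (2 * n) (λ w → M p w ℤ.* + 1)           ≡⟨ Σ-cong (λ w → trans (ℤ.*-identityʳ _) (M-entry p w)) ⟩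
      Σ (2 * n) (λ w → + F (g \\ decode n w))   ≡⟨ Σ-decode (λ d → F (g \\ d)) ⟩
      + ∑ᴰ (λ d → F (g \\ d))                   ≡⟨ cong +_ (∑ᴰ-\\ˡ g F) ⟩
      + ∑ᴰ F                                    ∎
      where g = decode n p

    J·M≡∑ : ∀ p q → (Jᴹ ·ᴹ M) p q ≡ + ∑ᴰ F
    J·M≡∑ p q = begin
      Σ (2 * n) (λ w → + 1 ℤ.* M w q)           ≡⟨ Σ-cong (λ w → trans (ℤ.*-identityˡ _) (M-entry w q)) ⟩
      Σ (2 * n) (λ w → + F (decode n w \\ h))   ≡⟨ Σ-decode (λ d → F (d \\ h)) ⟩
      + ∑ᴰ (λ d → F (d \\ h))                   ≡⟨ cong +_ (∑ᴰ-\\ʳ h F) ⟩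
      + ∑ᴰ F                                    ∎
      where h = decode n q

    M·M≡∑ : ∀ p q → (M ·ᴹ M) p q ≡ + ∑ᴰ (λ d → F d * F (d \\ (decode n p \\ decode n q)))
    M·M≡∑ p q = begin
      Σ (2 * n) (λ w → M p w ℤ.* M w q)
        ≡⟨ Σ-cong (λ w → trans (cong₂ ℤ._*_ (M-entry p w) (M-entry w q)) (sym (ℤ.pos-* (F (g \\ decode n w)) _))) ⟩
      Σ (2 * n) (λ w → + (F (g \\ decode n w) * F (decode n w \\ h)))
        ≡⟨ Σ-decode (λ d → F (g \\ d) * F (d \\ h)) ⟩
      + ∑ᴰ (λ d → F (g \\ d) * F (d \\ h))
        ≡⟨ cong +_ (∑ᴰ-walks g h F F) ⟩
      + ∑ᴰ (λ d → F d * F (d \\ (g \\ h)))      ∎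
      where
      g = decode n p
      h = decode n q

module DihedralDSRG (n v : ℕ) .{{_ : NonZero n}} .{{_ : NonZero v}} (v∣n : v ∣ n) (H X Y : Subset n)
  (Y-def : ∀ y → y ∈ Y ⇔ (∃[ h ] ∃[ k ] (h ∈ H × y ≡ (toℕ h + v * k) mod n)))
  (X-def : ∀ z → z ∈ X ⇔ (z ∈ Y × ¬ (v ∣ toℕ z)))
  (Y⊎-Y : ∀ z → ind (z ∈? Y) + ind (negₙ n z ∈? Y) ≡ 1 + ind (v ∣? toℕ z)) where

  open ℤₙ n
  open Dihedral n

  x y [v∣] : Fin n → ℕ
  x z = ind (z ∈? X)
  y z = ind (z ∈? Y)
  [v∣] z = ind (v ∣? toℕ z)

  χ : Dih n → ℕ
  χ (z , false) = x z
  χ (z , true)  = y z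

  ∣X∣ ∣Y∣ l : ℕ
  ∣X∣ = ∑[ z < n ] x z
  ∣Y∣ = ∑[ z < n ] y z
  l   = ∑[ z < n ] [v∣] z

  DihAdj≡χ : ∀ p q → DihAdj n X Y p q ≡ + χ (decode n p \\ decode n q)
  DihAdj≡χ p q with decode n p \\ decode n q
  ... | z , false = if-does (z ∈? X)
  ... | z , true  = if-does (z ∈? Y)

  x+[v∣]≡y : ∀ z → x z + [v∣] z ≡ y z
  x+[v∣]≡y z with v ∣? toℕ z
  ... | yes v∣z = begin
    x z + 1 ≡⟨ cong (_+ 1) (ind-no (z ∈? X) (λ z∈X → proj₂ (Equivalence.to (X-def z) z∈X) v∣z)) ⟩
    1       ≡⟨ ind-yes (z ∈? Y) z∈Y ⟨
    y z     ∎
    where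
    z∈Y : z ∈ Y
    z∈Y = ind+ind≡2⇒P (z ∈? Y) (negₙ n z ∈? Y) (trans (Y⊎-Y z) (cong suc (ind-yes (v ∣? toℕ z) v∣z)))
  ... | no ¬v∣z = trans (ℕ.+-identityʳ (x z)) (ind-cong (z ∈? X) (z ∈? Y)
    (λ z∈X → proj₁ (Equivalence.to (X-def z) z∈X)) (λ z∈Y → Equivalence.from (X-def z) (z∈Y , ¬v∣z)))

  x+y∘-ₙ≡1 : ∀ z → x z + y (-ₙ z) ≡ 1
  x+y∘-ₙ≡1 z = ℕ.+-cancelʳ-≡ ([v∣] z) (x z + y (-ₙ z)) 1 (begin
    x z + y (-ₙ z) + [v∣] z ≡⟨ xy∙z≈xz∙y (x z) (y (-ₙ z)) ([v∣] z) ⟩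
    x z + [v∣] z + y (-ₙ z) ≡⟨ cong (_+ y (-ₙ z)) (x+[v∣]≡y z) ⟩
    y z + y (-ₙ z)          ≡⟨ Y⊎-Y z ⟩
    1 + [v∣] z              ∎)

  v∣-ₙ : ∀ {u} → v ∣ toℕ u → v ∣ toℕ (-ₙ u)
  v∣-ₙ {u} v∣u = subst (v ∣_) (sym (toℕ-mod (n ∸ toℕ u))) (%-presˡ-∣ v∣n∸u v∣n)
    where
    v∣n∸u : v ∣ n ∸ toℕ u
    v∣n∸u = ∣m+n∣m⇒∣n (subst (v ∣_) (sym (ℕ.m+[n∸m]≡n (ℕ.<⇒≤ (toℕ<n u)))) v∣n) v∣u

  Y-shift : ∀ u a → v ∣ toℕ u → a ∈ Y → u +ₙ a ∈ Y
  Y-shift u a (divides q u≡qv) a∈Y with Equivalence.to (Y-def a) a∈Y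
  ... | h , k , h∈H , a≡h+vk = Equivalence.from (Y-def (u +ₙ a)) (h , q + k , h∈H , mod-cong (begin
    (toℕ u + toℕ a) % n                       ≡⟨ cong (λ z → (toℕ u + toℕ z) % n) a≡h+vk ⟩
    (toℕ u + toℕ ((toℕ h + v * k) mod n)) % n ≡⟨ cong (λ z → (toℕ u + z) % n) (toℕ-mod _) ⟩
    (toℕ u + (toℕ h + v * k) % n) % n         ≡⟨ [a+b%n]%n≡[a+b]%n _ _ ⟩
    (toℕ u + (toℕ h + v * k)) % n             ≡⟨ cong (λ z → (z + (toℕ h + v * k)) % n) u≡qv ⟩
    (q * v + (toℕ h + v * k)) % n             ≡⟨ cong (_% n) (regroup q v (toℕ h) k) ⟩
    (toℕ h + v * (q + k)) % n                 ∎))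
    where
    regroup : ∀ q v h k → q * v + (h + v * k) ≡ h + v * (q + k)
    regroup = solve-∀

  y-periodic : ∀ u a → v ∣ toℕ u → y (u +ₙ a) ≡ y a
  y-periodic u a v∣u = ind-cong (u +ₙ a ∈? Y) (a ∈? Y)
    (λ u+a∈Y → subst (_∈ Y) (-ₙa+ₙ[a+ₙb]≡b u a) (Y-shift (-ₙ u) (u +ₙ a) (v∣-ₙ v∣u) u+a∈Y))
    (Y-shift u a v∣u)

  ∑x*f+l*c≡∑y*f : ∀ (f : Fin n → ℕ) c → (∀ u → v ∣ toℕ u → f u ≡ c) →
                  ∑[ u < n ] (x u * f u) + l * c ≡ ∑[ u < n ] (y u * f u)
  ∑x*f+l*c≡∑y*f f c f≡c = begin
    ∑[ u < n ] (x u * f u) + l * c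
      ≡⟨ cong (_+_ (∑[ u < n ] (x u * f u))) (*-distribʳ-sum c [v∣]) ⟩
    ∑[ u < n ] (x u * f u) + ∑[ u < n ] ([v∣] u * c)
      ≡⟨ cong (_+_ (∑[ u < n ] (x u * f u))) (sum-cong-≗ (λ u → ind*-cong (v ∣? toℕ u) (sym ∘ f≡c u))) ⟩
    ∑[ u < n ] (x u * f u) + ∑[ u < n ] ([v∣] u * f u)
      ≡⟨ ∑-distrib-+ (λ u → x u * f u) (λ u → [v∣] u * f u) ⟨
    ∑[ u < n ] (x u * f u + [v∣] u * f u)
      ≡⟨ sum-cong-≗ (λ u → trans (sym (ℕ.*-distribʳ-+ (f u) (x u) ([v∣] u))) (cong (_* f u) (x+[v∣]≡y u))) ⟩
    ∑[ u < n ] (y u * f u) ∎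

  ∑f*x+∑f*y≡∑f : ∀ (f : Fin n → ℕ) (w w′ : Fin n → Fin n) → (∀ u → -ₙ w u ≡ w′ u) →
                 ∑[ u < n ] (f u * x (w u)) + ∑[ u < n ] (f u * y (w′ u)) ≡ ∑[ u < n ] f u
  ∑f*x+∑f*y≡∑f f w w′ -w≡w′ = trans (sym (∑-distrib-+ (λ u → f u * x (w u)) (λ u → f u * y (w′ u))))
    (sum-cong-≗ (λ u → begin
      f u * x (w u) + f u * y (w′ u)   ≡⟨ ℕ.*-distribˡ-+ (f u) _ _ ⟨
      f u * (x (w u) + y (w′ u))       ≡⟨ cong (λ z → f u * (x (w u) + y z)) (-w≡w′ u) ⟨
      f u * (x (w u) + y (-ₙ w u))     ≡⟨ cong (f u *_) (x+y∘-ₙ≡1 (w u)) ⟩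
      f u * 1                          ≡⟨ ℕ.*-identityʳ (f u) ⟩
      f u                              ∎))

  ∣X∣+l≡∣Y∣ : ∣X∣ + l ≡ ∣Y∣
  ∣X∣+l≡∣Y∣ = trans (sym (∑-distrib-+ x [v∣])) (sum-cong-≗ x+[v∣]≡y)

  ∣Y∣+∣Y∣≡n+l : ∣Y∣ + ∣Y∣ ≡ n + l
  ∣Y∣+∣Y∣≡n+l = begin
    ∣Y∣ + ∣Y∣                            ≡⟨ cong (_+_ ∣Y∣) (∑--ₙ y) ⟨
    ∣Y∣ + ∑[ z < n ] y (-ₙ z)            ≡⟨ ∑-distrib-+ y (y ∘ -ₙ_) ⟨
    ∑[ z < n ] (y z + y (-ₙ z))          ≡⟨ sum-cong-≗ Y⊎-Y ⟩
    ∑[ z < n ] (1 + [v∣] z)              ≡⟨ ∑-distrib-+ (λ _ → 1) [v∣] ⟩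
    ∑[ z < n ] 1 + l                     ≡⟨ cong (_+ l) (trans (∑-const n 1) (ℕ.*-identityʳ n)) ⟩
    n + l                                ∎

  n≡∣X∣+∣X∣+l : n ≡ ∣X∣ + ∣X∣ + l
  n≡∣X∣+∣X∣+l = ℕ.+-cancelʳ-≡ l n (∣X∣ + ∣X∣ + l) (begin
    n + l                  ≡⟨ ∣Y∣+∣Y∣≡n+l ⟨
    ∣Y∣ + ∣Y∣              ≡⟨ cong₂ _+_ ∣X∣+l≡∣Y∣ ∣X∣+l≡∣Y∣ ⟨
    ∣X∣ + l + (∣X∣ + l)    ≡⟨ regroup ∣X∣ l ⟩
    ∣X∣ + ∣X∣ + l + l      ∎)
    where
    regroup : ∀ a l → a + l + (a + l) ≡ a + a + l + l
    regroup = solve-∀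

  l≡n/v : l ≡ n / v
  l≡n/v = trans (cong (λ N → ∑[ k < N ] ind (v ∣? toℕ k)) (sym (m/n*n≡m v∣n))) (∑-multiples v (n / v))

  walks+l*χ≡∣X∣+l : ∀ m → ∑ᴰ (λ d → χ d * χ (d \\ m)) + l * χ m ≡ ∣X∣ + l
  walks+l*χ≡∣X∣+l (j , false) = begin
    ∑[ u < n ] (x u * x (-ₙ u +ₙ j)) + ∑[ u < n ] (y u * y (u - j)) + l * x j
      ≡⟨ cong (λ s → ∑[ u < n ] (x u * x (-ₙ u +ₙ j)) + s + l * x j)
              (∑x*f+l*c≡∑y*f (λ u → y (u - j)) (y (-ₙ j)) (λ u → y-periodic u (-ₙ j))) ⟨
    ∑[ u < n ] (x u * x (-ₙ u +ₙ j)) + (∑[ u < n ] (x u * y (u - j)) + l * y (-ₙ j)) + l * x j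
      ≡⟨ regroup (∑[ u < n ] (x u * x (-ₙ u +ₙ j))) (∑[ u < n ] (x u * y (u - j))) l (y (-ₙ j)) (x j) ⟩
    ∑[ u < n ] (x u * x (-ₙ u +ₙ j)) + ∑[ u < n ] (x u * y (u - j)) + l * (x j + y (-ₙ j))
      ≡⟨ cong₂ (λ s t → s + l * t)
               (∑f*x+∑f*y≡∑f x (λ u → -ₙ u +ₙ j) (λ u → u - j) (λ u → -ₙ[-ₙa+ₙb]≡a-b u j))
               (x+y∘-ₙ≡1 j) ⟩
    ∣X∣ + l * 1
      ≡⟨ cong (_+_ ∣X∣) (ℕ.*-identityʳ l) ⟩
    ∣X∣ + l ∎
    where
    regroup : ∀ a b l c d → a + (b + l * c) + l * d ≡ a + b + l * (d + c)
    regroup = solve-∀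
  walks+l*χ≡∣X∣+l (j , true) = begin
    ∑[ u < n ] (x u * y (-ₙ u +ₙ j)) + ∑[ u < n ] (y u * x (u - j)) + l * y j
      ≡⟨ xy∙z≈xz∙y (∑[ u < n ] (x u * y (-ₙ u +ₙ j))) (∑[ u < n ] (y u * x (u - j))) (l * y j) ⟩
    ∑[ u < n ] (x u * y (-ₙ u +ₙ j)) + l * y j + ∑[ u < n ] (y u * x (u - j))
      ≡⟨ cong (_+ ∑[ u < n ] (y u * x (u - j)))
              (∑x*f+l*c≡∑y*f (λ u → y (-ₙ u +ₙ j)) (y j) (λ u v∣u → y-periodic (-ₙ u) j (v∣-ₙ v∣u))) ⟩
    ∑[ u < n ] (y u * y (-ₙ u +ₙ j)) + ∑[ u < n ] (y u * x (u - j))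
      ≡⟨ ℕ.+-comm (∑[ u < n ] (y u * y (-ₙ u +ₙ j))) _ ⟩
    ∑[ u < n ] (y u * x (u - j)) + ∑[ u < n ] (y u * y (-ₙ u +ₙ j))
      ≡⟨ ∑f*x+∑f*y≡∑f y (λ u → u - j) (λ u → -ₙ u +ₙ j) (λ u → -ₙ[a-b]≡-ₙa+ₙb u j) ⟩
    ∣Y∣
      ≡⟨ ∣X∣+l≡∣Y∣ ⟨
    ∣X∣ + l ∎

  ∑ᴰχ≡n : ∑ᴰ χ ≡ n
  ∑ᴰχ≡n = begin
    ∣X∣ + ∣Y∣          ≡⟨ cong (_+_ ∣X∣) ∣X∣+l≡∣Y∣ ⟨
    ∣X∣ + (∣X∣ + l)    ≡⟨ ℕ.+-assoc ∣X∣ ∣X∣ l ⟨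
    ∣X∣ + ∣X∣ + l      ≡⟨ n≡∣X∣+∣X∣+l ⟨
    n                  ∎

  μ λ′ : ℕ
  μ  = (n + n / v) / 2
  λ′ = (n ∸ n / v) / 2

  μ≡∣X∣+l : μ ≡ ∣X∣ + l
  μ≡∣X∣+l = trans (cong (λ k → (n + k) / 2) (sym l≡n/v)) ([n+l]/2≡a+l ∣X∣ l n≡∣X∣+∣X∣+l)

  λ′≡∣X∣ : λ′ ≡ ∣X∣
  λ′≡∣X∣ = trans (cong (λ k → (n ∸ k) / 2) (sym l≡n/v)) ([n∸l]/2≡a ∣X∣ l n≡∣X∣+∣X∣+l)

  isDSRG : IsDSRG (2 * n) n μ λ′ μ (DihAdj n X Y)
  isDSRG = row-sums , column-sums , square
    where
    open CayleyMatrix χ (DihAdj n X Y) DihAdj≡χ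
    row-sums : ∀ p q → (DihAdj n X Y ·ᴹ Jᴹ) p q ≡ + n ℤ.* + 1
    row-sums p q = trans (M·J≡∑ p q) (trans (cong +_ ∑ᴰχ≡n) (sym (ℤ.*-identityʳ (+ n))))
    column-sums : ∀ p q → (Jᴹ ·ᴹ DihAdj n X Y) p q ≡ + n ℤ.* + 1
    column-sums p q = trans (J·M≡∑ p q) (trans (cong +_ ∑ᴰχ≡n) (sym (ℤ.*-identityʳ (+ n))))
    square : ∀ p q → (DihAdj n X Y ·ᴹ DihAdj n X Y) p q ≡
             + μ ℤ.* Iᴹ p q ℤ.+ + λ′ ℤ.* DihAdj n X Y p q ℤ.+ + μ ℤ.* (+ 1 ℤ.- Iᴹ p q ℤ.- DihAdj n X Y p q)
    square p q = begin
      (DihAdj n X Y ·ᴹ DihAdj n X Y) p q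
        ≡⟨ M·M≡∑ p q ⟩
      + ∑ᴰ (λ d → χ d * χ (d \\ m))
        ≡⟨ dsrg-entry {λ′ = λ′} {l} (Iᴹ p q) (trans μ≡∣X∣+l (cong (_+ l) (sym λ′≡∣X∣)))
                      (trans (walks+l*χ≡∣X∣+l m) (sym μ≡∣X∣+l)) ⟩
      + μ ℤ.* Iᴹ p q ℤ.+ + λ′ ℤ.* + χ m ℤ.+ + μ ℤ.* (+ 1 ℤ.- Iᴹ p q ℤ.- + χ m)
        ≡⟨ cong (λ A → + μ ℤ.* Iᴹ p q ℤ.+ + λ′ ℤ.* A ℤ.+ + μ ℤ.* (+ 1 ℤ.- Iᴹ p q ℤ.- A)) (DihAdj≡χ p q) ⟨
      + μ ℤ.* Iᴹ p q ℤ.+ + λ′ ℤ.* DihAdj n X Y p q ℤ.+ + μ ℤ.* (+ 1 ℤ.- Iᴹ p q ℤ.- DihAdj n X Y p q) ∎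
      where m = decode n p \\ decode n q

mainTheorem14 : (n v : ℕ) .{{_ : NonZero n}} .{{_ : NonZero v}} →
    v ∣ n → v % 2 ≡ 1 →
    (H X Y : Subset n) →
    (∀ h → h ∈ H → toℕ h < v) →
    (0 mod n) ∈ H →
    (∀ y → y ∈ Y ⇔ (∃[ h ] ∃[ k ] (h ∈ H × y ≡ (toℕ h + v * k) mod n))) →
    (∀ z → z ∈ X ⇔ (z ∈ Y × ¬ (v ∣ toℕ z))) →
    (∀ z → ind (z ∈? Y) + ind (negₙ n z ∈? Y) ≡ 1 + ind (v ∣? toℕ z)) →
    IsDSRG (2 * n) n ((n + n / v) / 2) ((n ∸ n / v) / 2) ((n + n / v) / 2)
      (DihAdj n X Y)
mainTheorem14 n v v∣n _ H X Y _ _ Y-def X-def Y⊎-Y = DihedralDSRG.isDSRG n v v∣n H X Y Y-def X-def Y⊎-Y
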